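{- Let $d\ge1$ be an integer, $m$ a positive odd integer, and $H_m=\sum_\lambda\lambda E_\lambda$ the spectral decomposition of the matrix $H_m$ defined below. Let $a=\mathbf{0}$ and $b=\mathbf{1}$ (the all-ones vector) in $\mathbb{Z}_2^d$. Then: (i) $a$ and $b$ are strongly cospectral relative to $H_m$; (ii) the eigenvalue support $\Lambda_a$ is symmetric about zero (i.e. $\lambda\in\Lambda_a$ iff $-\lambda\in\Lambda_a$). Moreover, if $d$ is even then $\lambda\in\Lambda_{ab}^+\iff-\lambda\in\Lambda_{ab}^+$ and $\lambda\in\Lambda_{ab}^-\iff-\lambda\in\Lambda_{ab}^-$; and if $d$ is odd then $\lambda\in\Lambda_{ab}^+\iff-\lambda\in\Lambda_{ab}^-$ and $\lambda\in\Lambda_{ab}^-\iff-\lambda\in\Lambda_{ab}^+$.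
   Context: $e_0,\dots,e_{d-1}$ are the standard basis vectors of $\mathbb{Z}_2^d$. $H_m$ is the $\mathbb{Z}_2^d\times\mathbb{Z}_2^d$ matrix with $(H_m)_{u,v}=m$ if $u-v=e_0$, $2$ if $u-v=e_j$ for some $1\le j\le d-1$, and $0$ otherwise. Vertices $a,b$ are strongly cospectral relative to $H_m$ if for every eigenprojection $E_\lambda$ there is a unimodular $\mu_\lambda$ with $E_\lambda e_a=\mu_\lambda E_\lambda e_b$. $\Lambda_a=\{\lambda:E_\lambda e_a\neq0\}$. The plus and minus sets are taken relative to $1$: $\Lambda_{ab}^+=\{\lambda:E_\lambda e_a=E_\lambda e_b\neq0\}$ and $\Lambda_{ab}^-=\{\lambda:E_\lambda e_a=-E_\lambda e_b\neq0\}$. -}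

module Defs where

open import Data.Nat as ℕ using (ℕ; zero; suc)
open import Data.Integer using (+_)
open import Data.Rational using (ℚ; 0ℚ; 1ℚ; _+_; _*_; -_; _/_)
open import Data.Bool using (Bool; true; false; _xor_; if_then_else_)
open import Data.Vec using (Vec; []; _∷_; zipWith; replicate)
open import Data.Vec.Properties using (≡-dec)
import Data.Bool.Properties as BoolP
open import Data.Fin using (Fin)
import Data.Fin.Properties as FinP
open import Data.List using (List; [_]; map; _++_; foldr; allFin)
open import Data.Product using (Σ; ∃; _×_; _,_)
open import Data.Sum using (_⊎_)
open import Relation.Nullary using (¬_; yes; no)
open import Relation.Binary.PropositionalEquality using (_≡_)

-- Vertices of the Cayley graph on Z_2^d: bit vectors of length d.
-- Coordinate 0 (the head of the vector) corresponds to e_0.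
V : ℕ → Set
V d = Vec Bool d

allV : (d : ℕ) → List (V d)
allV zero = [ [] ]
allV (suc d) = map (false ∷_) (allV d) ++ map (true ∷_) (allV d)

sumℚ : List ℚ → ℚ
sumℚ = foldr _+_ 0ℚ

Mat : ℕ → Set
Mat d = V d → V d → ℚ

_⊗_ : {d : ℕ} → Mat d → Mat d → Mat d
_⊗_ {d} A B u v = sumℚ (map (λ w → A u w * B w v) (allV d))

Id : (d : ℕ) → Mat d
Id d u v with ≡-dec BoolP._≟_ u v
... | yes _ = 1ℚ
... | no  _ = 0ℚ

ℕ→ℚ : ℕ → ℚ
ℕ→ℚ n = (+ n) / 1

numTrue : {n : ℕ} → Vec Bool n → ℕ
numTrue [] = 0
numTrue (true ∷ xs) = suc (numTrue xs)
numTrue (false ∷ xs) = numTrue xs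

-- weight of the difference vector w = u - v (= u xor v in Z_2^d):
--   m if w = e_0, 2 if w = e_j with 1 ≤ j ≤ d-1, 0 otherwise.
weight : {n : ℕ} → ℕ → Vec Bool n → ℚ
weight m [] = 0ℚ
weight m (true ∷ xs) with numTrue xs
... | zero = ℕ→ℚ m
... | suc _ = 0ℚ
weight m (false ∷ xs) with numTrue xs
... | 1 = ℕ→ℚ 2
... | _ = 0ℚ

H : (d m : ℕ) → Mat d
H d m u v = weight m (zipWith _xor_ u v)

sumFin : (r : ℕ) → (Fin r → ℚ) → ℚ
sumFin r f = sumℚ (map f (allFin r))

record SpectralDecomp (d : ℕ) (M : Mat d) : Set where
  field
    r       : ℕ
    ev      : Fin r → ℚ
    E       : Fin r → Mat d
    ev-inj  : ∀ i j → ev i ≡ ev j → i ≡ j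
    E-sym   : ∀ i u v → E i u v ≡ E i v u
    E-orth  : ∀ i j u v → (E i ⊗ E j) u v ≡
                (if Relation.Nullary.does (i FinP.≟ j) then E i u v else 0ℚ)
    E-nz    : ∀ i → ¬ (∀ u v → E i u v ≡ 0ℚ)
    E-sum   : ∀ u v → sumFin r (λ i → E i u v) ≡ Id d u v
    decomp  : ∀ u v → M u v ≡ sumFin r (λ i → ev i * E i u v)

module _ {d : ℕ} {M : Mat d} (S : SpectralDecomp d M) where
  open SpectralDecomp S

  ColNZ : Fin r → V d → Set
  ColNZ i a = ¬ (∀ u → E i u a ≡ 0ℚ)

  -- a, b strongly cospectral: E_i e_a = μ_i E_i e_b, μ_i unimodular
  -- (for real matrices/vectors the relevant unimodular scalars are ±1)
  StronglyCospectral : V d → V d → Set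
  StronglyCospectral a b =
    ∀ i → Σ ℚ λ μ → (μ ≡ 1ℚ ⊎ μ ≡ - 1ℚ) × (∀ u → E i u a ≡ μ * E i u b)

  InSupp : V d → ℚ → Set
  InSupp a λ' = Σ (Fin r) λ i → ev i ≡ λ' × ColNZ i a

  InPlus : V d → V d → ℚ → Set
  InPlus a b λ' = Σ (Fin r) λ i → ev i ≡ λ' × (∀ u → E i u a ≡ E i u b) × ColNZ i a

  InMinus : V d → V d → ℚ → Set
  InMinus a b λ' = Σ (Fin r) λ i → ev i ≡ λ' × (∀ u → E i u a ≡ - E i u b) × ColNZ i a

-- The characters χ t u = (-1)^⟨t,u⟩ of ℤ₂^d are left eigenvectors of the Cayley matrix H_m,
-- with eigenvalue λ_t = ±m + 2 Σ_{j≥1} (-1)^{t_j}, the sign being + iff t_0 = 0.  Testing a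
-- spectral decomposition against them shows that the Fourier transform of the column E_i e_c
-- is t ↦ [λ_t = ev i] χ t c, so by Fourier inversion E_i e_c = μ E_i e_c′ as soon as
-- χ t c = μ χ t c′ whenever λ_t = ev i.  For a = 𝟘 and b = 𝟙 this asks 1 = μ (-1)^|t|, and
-- for odd m the eigenvalue λ_t determines |t|: this gives strong cospectrality with μ = ±1,
-- and identifies Λ_a, Λ⁺_ab and Λ⁻_ab with the sets of all λ_t, of those with |t| even and
-- of those with |t| odd.  Finally t ↦ t ⊕ 𝟙 negates λ_t and changes the parity of |t| by
-- that of d.

module Submission where

open import Defs
open import Data.Nat as ℕ using (ℕ; zero; suc; parity; _^_; _≤_; _<_)
import Data.Nat.Properties as ℕ
open import Data.Nat.Coprimality as Coprime using (1-coprimeTo)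
open import Data.Nat.Divisibility using (_∣_; divides; _∣0; ∣-refl; ∣m∣n⇒∣m+n; ∣m+n∣m⇒∣n; m∣m*n)
import Data.Integer as ℤ
import Data.Integer.Properties as ℤ
open import Data.Parity.Base as ℙ using (Parity; 0ℙ; 1ℙ)
import Data.Parity.Properties as ℙ
open import Data.Bool using (Bool; true; false; _∧_; _xor_; if_then_else_)
import Data.Bool.Properties as Bool
open import Data.Vec using ([]; _∷_; zipWith; replicate; tail)
open import Data.Vec.Properties using (≡-dec)
open import Data.Rational using (ℚ; mkℚ; ↥_; 0ℚ; 1ℚ; _+_; _*_; -_; _/_; 1/_; _≟_; ≢-nonZero)
import Data.Rational.Properties as ℚ
open import Data.Fin using (Fin; zero; suc; punchIn)
import Data.Fin.Properties as Fin
open import Data.List using (List; _++_; map; tabulate)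
open import Data.List.Properties using (map-++; map-tabulate; map-∘)
open import Data.Product using (Σ; ∃; _×_; _,_; proj₁; proj₂)
open import Data.Sum using (_⊎_; inj₁; inj₂)
open import Data.Empty using (⊥-elim)
open import Function using (_∘_; id)
open import Function.Bundles using (_⇔_; mk⇔; Equivalence)
open import Function.Construct.Composition using (_⇔-∘_)
open import Function.Construct.Symmetry using (⇔-sym)
open import Relation.Nullary using (¬_; yes; no; does; Dec)
open import Relation.Nullary.Decidable using (map′; _⊎-dec_; dec⇒maybe)
open import Relation.Binary.PropositionalEquality
open import Algebra.Bundles using (CommutativeMonoid; CommutativeRing)
open import Algebra.Properties.Group ℚ.+-0-group using () renaming (∙-cancelˡ to +-cancelˡ)
open import Algebra.Properties.Ring ℚ.+-*-ring using (-1*x≈-x; -‿involutive)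
open import Algebra.Properties.CommutativeSemigroup
  (CommutativeMonoid.commutativeSemigroup ℚ.+-0-commutativeMonoid)
  using () renaming (interchange to +-interchange)
open import Algebra.Properties.CommutativeSemigroup
  (CommutativeMonoid.commutativeSemigroup ℚ.*-1-commutativeMonoid)
  using () renaming (x∙yz≈y∙xz to *-left-comm)
open import Algebra.Properties.CommutativeSemigroup
  (CommutativeMonoid.commutativeSemigroup ℙ.+-0-commutativeMonoid)
  using () renaming (interchange to ℙ-interchange)
open import Algebra.Properties.Semiring.Sum (CommutativeRing.semiring ℚ.+-*-commutativeRing)
  using (sum; sum-remove; sum-cong-≗; sum-replicate-zero; *-distribˡ-sum; *-distribʳ-sum)
  renaming (∑-distrib-+ to sum-distrib-+)
open import Tactic.RingSolver using (solve-∀)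
open import Tactic.RingSolver.Core.AlmostCommutativeRing using (AlmostCommutativeRing; fromCommutativeRing)

open ≡-Reasoning

ℚ-ring : AlmostCommutativeRing _ _
ℚ-ring = fromCommutativeRing ℚ.+-*-commutativeRing (dec⇒maybe ∘ (0ℚ ≟_))

ℕ→ℚ-mkℚ : ∀ n → ℕ→ℚ n ≡ mkℚ (ℤ.+ n) 0 (Coprime.sym (1-coprimeTo n))
ℕ→ℚ-mkℚ n = ℚ.normalize-coprime (Coprime.sym (1-coprimeTo n))

ℕ→ℚ-homo-+ : ∀ a b → ℕ→ℚ (a ℕ.+ b) ≡ ℕ→ℚ a + ℕ→ℚ b
ℕ→ℚ-homo-+ a b = sym (trans (cong₂ _+_ (ℕ→ℚ-mkℚ a) (ℕ→ℚ-mkℚ b))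
  (cong (_/ 1) (trans (cong₂ ℤ._+_ (ℤ.*-identityʳ (ℤ.+ a)) (ℤ.*-identityʳ (ℤ.+ b))) (sym (ℤ.pos-+ a b)))))

ℕ→ℚ-homo-* : ∀ a b → ℕ→ℚ (a ℕ.* b) ≡ ℕ→ℚ a * ℕ→ℚ b
ℕ→ℚ-homo-* a b = sym (trans (cong₂ _*_ (ℕ→ℚ-mkℚ a) (ℕ→ℚ-mkℚ b))
  (cong (_/ 1) (sym (ℤ.pos-* a b))))

ℕ→ℚ-injective : ∀ {a b} → ℕ→ℚ a ≡ ℕ→ℚ b → a ≡ b
ℕ→ℚ-injective {a} {b} eq =
  ℤ.+-injective (cong ↥_ (trans (sym (ℕ→ℚ-mkℚ a)) (trans eq (ℕ→ℚ-mkℚ b))))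

*-cancelˡ-≢0 : ∀ k {p q} → k ≢ 0ℚ → k * p ≡ k * q → p ≡ q
*-cancelˡ-≢0 k {p} {q} k≢0 eq = begin
  p                ≡⟨ sym (ℚ.*-identityˡ p) ⟩
  1ℚ * p           ≡⟨ cong (_* p) (sym (ℚ.*-inverseˡ k)) ⟩
  (1/ k * k) * p   ≡⟨ ℚ.*-assoc (1/ k) k p ⟩
  1/ k * (k * p)   ≡⟨ cong (1/ k *_) eq ⟩
  1/ k * (k * q)   ≡⟨ sym (ℚ.*-assoc (1/ k) k q) ⟩
  (1/ k * k) * q   ≡⟨ cong (_* q) (ℚ.*-inverseˡ k) ⟩
  1ℚ * q           ≡⟨ ℚ.*-identityˡ q ⟩
  q                ∎
  where
  instance _ = ≢-nonZero k≢0

2∣⇒parity≡0ℙ : ∀ {n} → 2 ∣ n → parity n ≡ 0ℙ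
2∣⇒parity≡0ℙ (divides k refl) = trans (ℙ.*-homo-* k 2) (ℙ.*-zeroʳ (parity k))

parity≡0ℙ⇒2∣ : ∀ n → parity n ≡ 0ℙ → 2 ∣ n
parity≡0ℙ⇒2∣ zero _ = 2 ∣0
parity≡0ℙ⇒2∣ (suc (suc n)) eq = ∣m∣n⇒∣m+n (∣-refl {2}) (parity≡0ℙ⇒2∣ n eq)

¬2∣⇒parity≡1ℙ : ∀ {n} → ¬ 2 ∣ n → parity n ≡ 1ℙ
¬2∣⇒parity≡1ℙ {n} ¬2∣n with parity n in eq
... | 0ℙ = ⊥-elim (¬2∣n (parity≡0ℙ⇒2∣ n eq))
... | 1ℙ = refl

-- Sums over ℤ₂^d and over Fin r

infixl 6 _⊕_

_⊕_ : ∀ {d} → V d → V d → V d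
_⊕_ = zipWith _xor_

∑ : ∀ {d} → (V d → ℚ) → ℚ
∑ {zero} f = f []
∑ {suc d} f = ∑ (f ∘ (false ∷_)) + ∑ (f ∘ (true ∷_))

infix 5 ∑
syntax ∑ (λ u → e) = ∑[ u ] e

∑-cong : ∀ {d} {f g : V d → ℚ} → (∀ u → f u ≡ g u) → ∑ f ≡ ∑ g
∑-cong {zero} f≗g = f≗g []
∑-cong {suc d} f≗g = cong₂ _+_ (∑-cong (f≗g ∘ (false ∷_))) (∑-cong (f≗g ∘ (true ∷_)))

∑-zero : ∀ {d} {f : V d → ℚ} → (∀ u → f u ≡ 0ℚ) → ∑ f ≡ 0ℚ
∑-zero {zero} f≗0 = f≗0 []
∑-zero {suc d} f≗0 = cong₂ _+_ (∑-zero (f≗0 ∘ (false ∷_))) (∑-zero (f≗0 ∘ (true ∷_)))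

∑-distrib-+ : ∀ {d} (f g : V d → ℚ) → ∑[ u ] (f u + g u) ≡ ∑ f + ∑ g
∑-distrib-+ {zero} f g = refl
∑-distrib-+ {suc d} f g =
  trans (cong₂ _+_ (∑-distrib-+ (f ∘ (false ∷_)) (g ∘ (false ∷_)))
                   (∑-distrib-+ (f ∘ (true ∷_)) (g ∘ (true ∷_))))
        (+-interchange (∑ (f ∘ (false ∷_))) (∑ (g ∘ (false ∷_)))
                       (∑ (f ∘ (true ∷_))) (∑ (g ∘ (true ∷_))))

*-distribˡ-∑ : ∀ {d} c (f : V d → ℚ) → c * ∑ f ≡ ∑[ u ] (c * f u)
*-distribˡ-∑ {zero} c f = refl
*-distribˡ-∑ {suc d} c f =
  trans (ℚ.*-distribˡ-+ c _ _)
        (cong₂ _+_ (*-distribˡ-∑ c (f ∘ (false ∷_))) (*-distribˡ-∑ c (f ∘ (true ∷_))))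

*-distribʳ-∑ : ∀ {d} c (f : V d → ℚ) → ∑ f * c ≡ ∑[ u ] f u * c
*-distribʳ-∑ c f = trans (ℚ.*-comm (∑ f) c) (trans (*-distribˡ-∑ c f) (∑-cong (λ u → ℚ.*-comm c (f u))))

∑-*-scale : ∀ {d} μ (h f g : V d → ℚ) → (∀ u → f u ≡ μ * g u) →
  ∑[ u ] h u * f u ≡ μ * (∑[ u ] h u * g u)
∑-*-scale μ h f g f≡μg =
  trans (∑-cong (λ u → trans (cong (h u *_) (f≡μg u)) (*-left-comm (h u) μ (g u))))
        (sym (*-distribˡ-∑ μ (λ u → h u * g u)))

∑-comm : ∀ {d e} (f : V d → V e → ℚ) → ∑[ u ] ∑[ v ] f u v ≡ ∑[ v ] ∑[ u ] f u v
∑-comm {zero} f = refl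
∑-comm {suc d} f =
  trans (cong₂ _+_ (∑-comm (f ∘ (false ∷_))) (∑-comm (f ∘ (true ∷_))))
        (sym (∑-distrib-+ (λ v → ∑[ u ] f (false ∷ u) v) (λ v → ∑[ u ] f (true ∷ u) v)))

∑-translate : ∀ {d} (w : V d) (f : V d → ℚ) → ∑[ u ] f (u ⊕ w) ≡ ∑ f
∑-translate [] f = refl
∑-translate (false ∷ w) f =
  cong₂ _+_ (∑-translate w (f ∘ (false ∷_))) (∑-translate w (f ∘ (true ∷_)))
∑-translate (true ∷ w) f =
  trans (cong₂ _+_ (∑-translate w (f ∘ (true ∷_))) (∑-translate w (f ∘ (false ∷_))))
        (ℚ.+-comm (∑ (f ∘ (true ∷_))) (∑ (f ∘ (false ∷_))))

∑-single : ∀ {d} (u : V d) {f : V d → ℚ} → (∀ w → w ≢ u → f w ≡ 0ℚ) → ∑ f ≡ f u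
∑-single [] f≗0 = refl
∑-single (false ∷ u) {f} f≗0 =
  trans (cong₂ _+_ (∑-single u (λ w w≢u → f≗0 _ (w≢u ∘ cong tail)))
                   (∑-zero {f = f ∘ (true ∷_)} (λ w → f≗0 _ λ ())))
        (ℚ.+-identityʳ _)
∑-single (true ∷ u) {f} f≗0 =
  trans (cong₂ _+_ (∑-zero {f = f ∘ (false ∷_)} (λ w → f≗0 _ λ ()))
                   (∑-single u (λ w w≢u → f≗0 _ (w≢u ∘ cong tail))))
        (ℚ.+-identityˡ _)

any? : ∀ {d} {P : V d → Set} → (∀ v → Dec (P v)) → Dec (∃ P)
any? {zero} P? = map′ ([] ,_) (λ { ([] , p) → p }) (P? [])
any? {suc d} {P} P? = map′ from to (any? (P? ∘ (false ∷_)) ⊎-dec any? (P? ∘ (true ∷_)))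
  where
  from : (∃ λ v → P (false ∷ v)) ⊎ (∃ λ v → P (true ∷ v)) → ∃ P
  from (inj₁ (v , p)) = false ∷ v , p
  from (inj₂ (v , p)) = true ∷ v , p
  to : ∃ P → (∃ λ v → P (false ∷ v)) ⊎ (∃ λ v → P (true ∷ v))
  to (false ∷ v , p) = inj₁ (v , p)
  to (true ∷ v , p) = inj₂ (v , p)

sumℚ-++ : ∀ (xs ys : List ℚ) → sumℚ (xs ++ ys) ≡ sumℚ xs + sumℚ ys
sumℚ-++ List.[] ys = sym (ℚ.+-identityˡ _)
sumℚ-++ (x List.∷ xs) ys = trans (cong (x +_) (sumℚ-++ xs ys)) (sym (ℚ.+-assoc x _ _))

sumℚ-allV : ∀ d (f : V d → ℚ) → sumℚ (map f (allV d)) ≡ ∑ f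
sumℚ-allV zero f = ℚ.+-identityʳ (f [])
sumℚ-allV (suc d) f = begin
  sumℚ (map f (map (false ∷_) (allV d) ++ map (true ∷_) (allV d)))
    ≡⟨ cong sumℚ (map-++ f (map (false ∷_) (allV d)) _) ⟩
  sumℚ (map f (map (false ∷_) (allV d)) ++ map f (map (true ∷_) (allV d)))
    ≡⟨ sumℚ-++ (map f (map (false ∷_) (allV d))) _ ⟩
  sumℚ (map f (map (false ∷_) (allV d))) + sumℚ (map f (map (true ∷_) (allV d)))
    ≡⟨ cong₂ _+_ (trans (cong sumℚ (sym (map-∘ (allV d)))) (sumℚ-allV d (f ∘ (false ∷_))))
                 (trans (cong sumℚ (sym (map-∘ (allV d)))) (sumℚ-allV d (f ∘ (true ∷_)))) ⟩
  ∑ f ∎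

sumℚ-tabulate : ∀ r (f : Fin r → ℚ) → sumℚ (tabulate f) ≡ sum f
sumℚ-tabulate zero f = refl
sumℚ-tabulate (suc r) f = cong (f zero +_) (sumℚ-tabulate r (f ∘ suc))

sumFin≡sum : ∀ r (f : Fin r → ℚ) → sumFin r f ≡ sum f
sumFin≡sum r f = trans (cong sumℚ (map-tabulate id f)) (sumℚ-tabulate r f)

∑-sum-comm : ∀ {d r} (f : V d → Fin r → ℚ) →
  ∑[ u ] sum (f u) ≡ sum (λ i → ∑[ u ] f u i)
∑-sum-comm {zero} f = refl
∑-sum-comm {suc d} f =
  trans (cong₂ _+_ (∑-sum-comm (f ∘ (false ∷_))) (∑-sum-comm (f ∘ (true ∷_))))
        (sym (sum-distrib-+ (λ i → ∑[ u ] f (false ∷ u) i) (λ i → ∑[ u ] f (true ∷ u) i)))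

sum-zero : ∀ {r} {f : Fin r → ℚ} → (∀ i → f i ≡ 0ℚ) → sum f ≡ 0ℚ
sum-zero {r} f≗0 = trans (sum-cong-≗ f≗0) (sum-replicate-zero r)

sum-single : ∀ {r} (i : Fin r) {f : Fin r → ℚ} → (∀ j → j ≢ i → f j ≡ 0ℚ) → sum f ≡ f i
sum-single {suc r} i {f} f≗0 = begin
  sum f                     ≡⟨ sum-remove {i = i} f ⟩
  f i + sum (f ∘ punchIn i) ≡⟨ cong (f i +_) (sum-zero (λ j → f≗0 _ (Fin.punchInᵢ≢i i j))) ⟩
  f i + 0ℚ                  ≡⟨ ℚ.+-identityʳ (f i) ⟩
  f i                       ∎

-- Spectral decompositions and left eigenvectors

_⋆_ : ∀ {d} → (V d → ℚ) → Mat d → V d → ℚ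
(x ⋆ A) c = ∑[ u ] x u * A u c

IsLeftEigenvector : ∀ {d} → Mat d → ℚ → (V d → ℚ) → Set
IsLeftEigenvector M λ' x = ∀ w → (x ⋆ M) w ≡ λ' * x w

module _ {d : ℕ} {M : Mat d} (S : SpectralDecomp d M) where
  open SpectralDecomp S

  if-≟-refl : ∀ {A : Set} (i : Fin r) (x y : A) → (if does (i Fin.≟ i) then x else y) ≡ x
  if-≟-refl i x y with i Fin.≟ i
  ... | yes _ = refl
  ... | no i≢i = ⊥-elim (i≢i refl)

  ev*if-≟-≢ : ∀ {i j} x → j ≢ i → ev j * (if does (j Fin.≟ i) then x else 0ℚ) ≡ 0ℚ
  ev*if-≟-≢ {i} {j} x j≢i with j Fin.≟ i
  ... | yes j≡i = ⊥-elim (j≢i j≡i)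
  ... | no _ = ℚ.*-zeroʳ (ev j)

  M*E≡ev*E : ∀ i u c → ∑[ w ] M u w * E i w c ≡ ev i * E i u c
  M*E≡ev*E i u c = begin
    ∑[ w ] M u w * E i w c
      ≡⟨ ∑-cong (λ w → cong (_* E i w c) (trans (decomp u w) (sumFin≡sum r _))) ⟩
    ∑[ w ] sum (λ j → ev j * E j u w) * E i w c
      ≡⟨ ∑-cong (λ w → *-distribʳ-sum (E i w c) (λ j → ev j * E j u w)) ⟩
    ∑[ w ] sum (λ j → ev j * E j u w * E i w c)
      ≡⟨ ∑-sum-comm (λ w j → ev j * E j u w * E i w c) ⟩
    sum (λ j → ∑[ w ] ev j * E j u w * E i w c)
      ≡⟨ sum-cong-≗ (λ j → ∑-cong (λ w → ℚ.*-assoc (ev j) (E j u w) (E i w c))) ⟩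
    sum (λ j → ∑[ w ] ev j * (E j u w * E i w c))
      ≡⟨ sum-cong-≗ (λ j → sym (*-distribˡ-∑ (ev j) (λ w → E j u w * E i w c))) ⟩
    sum (λ j → ev j * (∑[ w ] E j u w * E i w c))
      ≡⟨ sum-cong-≗ (λ j → cong (ev j *_) (trans (sym (sumℚ-allV d _)) (E-orth j i u c))) ⟩
    sum (λ j → ev j * (if does (j Fin.≟ i) then E j u c else 0ℚ))
      ≡⟨ sum-single i (λ j → ev*if-≟-≢ (E j u c)) ⟩
    ev i * (if does (i Fin.≟ i) then E i u c else 0ℚ)
      ≡⟨ cong (ev i *_) (if-≟-refl i (E i u c) 0ℚ) ⟩
    ev i * E i u c ∎

  Id-≡ : ∀ u → Id d u u ≡ 1ℚ
  Id-≡ u with ≡-dec Bool._≟_ u u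
  ... | yes _ = refl
  ... | no u≢u = ⊥-elim (u≢u refl)

  Id-≢ : ∀ {u v} → u ≢ v → Id d u v ≡ 0ℚ
  Id-≢ {u} {v} u≢v with ≡-dec Bool._≟_ u v
  ... | yes u≡v = ⊥-elim (u≢v u≡v)
  ... | no _ = refl

  ⋆-assoc : ∀ x (A B : Mat d) c → ((x ⋆ A) ⋆ B) c ≡ ∑[ u ] x u * (∑[ w ] A u w * B w c)
  ⋆-assoc x A B c = begin
    ∑[ w ] (∑[ u ] x u * A u w) * B w c
      ≡⟨ ∑-cong (λ w → *-distribʳ-∑ (B w c) (λ u → x u * A u w)) ⟩
    ∑[ w ] ∑[ u ] x u * A u w * B w c
      ≡⟨ ∑-comm (λ w u → x u * A u w * B w c) ⟩
    ∑[ u ] ∑[ w ] x u * A u w * B w c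
      ≡⟨ ∑-cong (λ u → ∑-cong (λ w → ℚ.*-assoc (x u) (A u w) (B w c))) ⟩
    ∑[ u ] ∑[ w ] x u * (A u w * B w c)
      ≡⟨ ∑-cong (λ u → sym (*-distribˡ-∑ (x u) (λ w → A u w * B w c))) ⟩
    ∑[ u ] x u * (∑[ w ] A u w * B w c) ∎

  ⋆-eigen : ∀ {λ' x} → IsLeftEigenvector M λ' x → ∀ i c → λ' * (x ⋆ E i) c ≡ ev i * (x ⋆ E i) c
  ⋆-eigen {λ'} {x} eigen i c = begin
    λ' * (∑[ w ] x w * E i w c)
      ≡⟨ *-distribˡ-∑ λ' (λ w → x w * E i w c) ⟩
    ∑[ w ] λ' * (x w * E i w c)
      ≡⟨ ∑-cong (λ w → trans (sym (ℚ.*-assoc λ' (x w) (E i w c))) (cong (_* E i w c) (sym (eigen w)))) ⟩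
    ((x ⋆ M) ⋆ E i) c
      ≡⟨ ⋆-assoc x M (E i) c ⟩
    ∑[ u ] x u * (∑[ w ] M u w * E i w c)
      ≡⟨ ∑-cong (λ u → trans (cong (x u *_) (M*E≡ev*E i u c)) (*-left-comm (x u) (ev i) (E i u c))) ⟩
    ∑[ u ] ev i * (x u * E i u c)
      ≡⟨ sym (*-distribˡ-∑ (ev i) (λ u → x u * E i u c)) ⟩
    ev i * (x ⋆ E i) c ∎

  ⋆-eigen-≢ : ∀ {λ' x} → IsLeftEigenvector M λ' x → ∀ i c → λ' ≢ ev i → (x ⋆ E i) c ≡ 0ℚ
  ⋆-eigen-≢ {λ'} {x} eigen i c λ'≢ev with (x ⋆ E i) c ≟ 0ℚ
  ... | yes X≡0 = X≡0
  ... | no X≢0 = ⊥-elim (λ'≢ev (*-cancelˡ-≢0 X X≢0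
          (trans (ℚ.*-comm X λ') (trans (⋆-eigen {λ'} {x} eigen i c) (ℚ.*-comm (ev i) X)))))
    where
    X : ℚ
    X = (x ⋆ E i) c

  sum-⋆E : ∀ x c → sum (λ i → (x ⋆ E i) c) ≡ x c
  sum-⋆E x c = begin
    sum (λ i → ∑[ u ] x u * E i u c)   ≡⟨ sym (∑-sum-comm (λ u i → x u * E i u c)) ⟩
    ∑[ u ] sum (λ i → x u * E i u c)   ≡⟨ ∑-cong (λ u → sym (*-distribˡ-sum (x u) (λ i → E i u c))) ⟩
    ∑[ u ] x u * sum (λ i → E i u c)
      ≡⟨ ∑-cong (λ u → cong (x u *_) (trans (sym (sumFin≡sum r _)) (E-sum u c))) ⟩
    ∑[ u ] x u * Id d u c
      ≡⟨ ∑-single c (λ u u≢c → trans (cong (x u *_) (Id-≢ u≢c)) (ℚ.*-zeroʳ (x u))) ⟩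
    x c * Id d c c                     ≡⟨ trans (cong (x c *_) (Id-≡ c)) (ℚ.*-identityʳ (x c)) ⟩
    x c                                ∎

  ⋆-eigen-≡ : ∀ {λ' x} → IsLeftEigenvector M λ' x → ∀ i c → λ' ≡ ev i → (x ⋆ E i) c ≡ x c
  ⋆-eigen-≡ {λ'} {x} eigen i c λ'≡ev =
    trans (sym (sum-single i (λ j j≢i → ⋆-eigen-≢ {λ'} {x} eigen j c
                                 (λ λ'≡evj → j≢i (ev-inj j i (trans (sym λ'≡evj) λ'≡ev))))))
          (sum-⋆E x c)

  left-eigenvalue∈ev : ∀ {λ' x} → IsLeftEigenvector M λ' x → ∀ c → x c ≢ 0ℚ → ∃ λ i → ev i ≡ λ'
  left-eigenvalue∈ev {λ'} {x} eigen c xc≢0 with Fin.any? (λ i → ev i ≟ λ')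
  ... | yes found = found
  ... | no none = ⊥-elim (xc≢0 (trans (sym (sum-⋆E x c))
          (sum-zero (λ i → ⋆-eigen-≢ {λ'} {x} eigen i c (λ λ'≡ev → none (i , sym λ'≡ev))))))

-- Characters of ℤ₂^d and the Fourier transform

𝟘 𝟙 : ∀ {d} → V d
𝟘 = replicate _ false
𝟙 = replicate _ true

bit : Bool → Parity
bit false = 0ℙ
bit true  = 1ℙ

bit-homo-xor : ∀ x y → bit (x xor y) ≡ bit x ℙ.+ bit y
bit-homo-xor false y = refl
bit-homo-xor true false = refl
bit-homo-xor true true = refl

⟨_,_⟩ : ∀ {d} → V d → V d → Parity
⟨ [] , [] ⟩ = 0ℙ
⟨ b ∷ s , c ∷ u ⟩ = bit (b ∧ c) ℙ.+ ⟨ s , u ⟩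

⟨,⟩-comm : ∀ {d} (s u : V d) → ⟨ s , u ⟩ ≡ ⟨ u , s ⟩
⟨,⟩-comm [] [] = refl
⟨,⟩-comm (b ∷ s) (c ∷ u) = cong₂ (λ x y → bit x ℙ.+ y) (Bool.∧-comm b c) (⟨,⟩-comm s u)

⟨,⟩-homoʳ : ∀ {d} (s u w : V d) → ⟨ s , u ⊕ w ⟩ ≡ ⟨ s , u ⟩ ℙ.+ ⟨ s , w ⟩
⟨,⟩-homoʳ [] [] [] = refl
⟨,⟩-homoʳ (b ∷ s) (c ∷ u) (c′ ∷ w) = begin
  bit (b ∧ (c xor c′)) ℙ.+ ⟨ s , u ⊕ w ⟩
    ≡⟨ cong₂ ℙ._+_ (trans (cong bit (Bool.∧-distribˡ-xor b c c′)) (bit-homo-xor (b ∧ c) (b ∧ c′)))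
                   (⟨,⟩-homoʳ s u w) ⟩
  (bit (b ∧ c) ℙ.+ bit (b ∧ c′)) ℙ.+ (⟨ s , u ⟩ ℙ.+ ⟨ s , w ⟩)
    ≡⟨ ℙ-interchange (bit (b ∧ c)) (bit (b ∧ c′)) ⟨ s , u ⟩ ⟨ s , w ⟩ ⟩
  (bit (b ∧ c) ℙ.+ ⟨ s , u ⟩) ℙ.+ (bit (b ∧ c′) ℙ.+ ⟨ s , w ⟩) ∎

⟨,⟩-homoˡ : ∀ {d} (s t u : V d) → ⟨ s ⊕ t , u ⟩ ≡ ⟨ s , u ⟩ ℙ.+ ⟨ t , u ⟩
⟨,⟩-homoˡ s t u = begin
  ⟨ s ⊕ t , u ⟩             ≡⟨ ⟨,⟩-comm (s ⊕ t) u ⟩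
  ⟨ u , s ⊕ t ⟩             ≡⟨ ⟨,⟩-homoʳ u s t ⟩
  ⟨ u , s ⟩ ℙ.+ ⟨ u , t ⟩   ≡⟨ cong₂ ℙ._+_ (⟨,⟩-comm u s) (⟨,⟩-comm u t) ⟩
  ⟨ s , u ⟩ ℙ.+ ⟨ t , u ⟩   ∎

⟨,𝟘⟩ : ∀ {d} (s : V d) → ⟨ s , 𝟘 ⟩ ≡ 0ℙ
⟨,𝟘⟩ [] = refl
⟨,𝟘⟩ (b ∷ s) = cong₂ (λ x y → bit x ℙ.+ y) (Bool.∧-zeroʳ b) (⟨,𝟘⟩ s)

⟨,𝟙⟩ : ∀ {d} (s : V d) → ⟨ s , 𝟙 ⟩ ≡ parity (numTrue s)
⟨,𝟙⟩ [] = refl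
⟨,𝟙⟩ (false ∷ s) = ⟨,𝟙⟩ s
⟨,𝟙⟩ (true ∷ s) = trans (cong (1ℙ ℙ.+_) (⟨,𝟙⟩ s)) (sym (ℙ.+-homo-+ 1 (numTrue s)))

numTrue-𝟙 : ∀ d → numTrue (𝟙 {d}) ≡ d
numTrue-𝟙 zero = refl
numTrue-𝟙 (suc d) = cong suc (numTrue-𝟙 d)

sgn : Parity → ℚ
sgn 0ℙ = 1ℚ
sgn 1ℙ = - 1ℚ

sgn-homo-+ : ∀ p q → sgn (p ℙ.+ q) ≡ sgn p * sgn q
sgn-homo-+ 0ℙ 0ℙ = refl
sgn-homo-+ 0ℙ 1ℙ = refl
sgn-homo-+ 1ℙ 0ℙ = refl
sgn-homo-+ 1ℙ 1ℙ = refl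

sgn*sgn : ∀ p → sgn p * sgn p ≡ 1ℚ
sgn*sgn 0ℙ = refl
sgn*sgn 1ℙ = refl

sgn≢0 : ∀ p → sgn p ≢ 0ℚ
sgn≢0 0ℙ ()
sgn≢0 1ℙ ()

sgn≡±1 : ∀ p → sgn p ≡ 1ℚ ⊎ sgn p ≡ - 1ℚ
sgn≡±1 0ℙ = inj₁ refl
sgn≡±1 1ℙ = inj₂ refl

1≡sgn*sgn⇒≡ : ∀ p q → 1ℚ ≡ sgn p * sgn q → p ≡ q
1≡sgn*sgn⇒≡ 0ℙ 0ℙ _ = refl
1≡sgn*sgn⇒≡ 1ℙ 1ℙ _ = refl
1≡sgn*sgn⇒≡ 0ℙ 1ℙ ()
1≡sgn*sgn⇒≡ 1ℙ 0ℙ ()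

χ : ∀ {d} → V d → V d → ℚ
χ s u = sgn ⟨ s , u ⟩

χ-homoʳ : ∀ {d} (s u w : V d) → χ s (u ⊕ w) ≡ χ s u * χ s w
χ-homoʳ s u w = trans (cong sgn (⟨,⟩-homoʳ s u w)) (sgn-homo-+ ⟨ s , u ⟩ ⟨ s , w ⟩)

χ-𝟘 : ∀ {d} (s : V d) → χ s 𝟘 ≡ 1ℚ
χ-𝟘 s = cong sgn (⟨,𝟘⟩ s)

⊕-cancelʳ : ∀ {d} (u w : V d) → (u ⊕ w) ⊕ w ≡ u
⊕-cancelʳ [] [] = refl
⊕-cancelʳ (b ∷ u) (c ∷ w) = cong₂ _∷_ eq (⊕-cancelʳ u w)
  where
  eq : (b xor c) xor c ≡ b
  eq = trans (Bool.xor-assoc b c c) (trans (cong (b xor_) (Bool.xor-same c)) (Bool.xor-identityʳ b))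

⊕≡𝟘⇒≡ : ∀ {d} (u w : V d) → u ⊕ w ≡ 𝟘 → u ≡ w
⊕≡𝟘⇒≡ [] [] _ = refl
⊕≡𝟘⇒≡ (false ∷ u) (false ∷ w) eq = cong (false ∷_) (⊕≡𝟘⇒≡ u w (cong tail eq))
⊕≡𝟘⇒≡ (true ∷ u) (true ∷ w) eq = cong (true ∷_) (⊕≡𝟘⇒≡ u w (cong tail eq))
⊕≡𝟘⇒≡ (false ∷ u) (true ∷ w) ()
⊕≡𝟘⇒≡ (true ∷ u) (false ∷ w) ()

∑-χ-≢𝟘 : ∀ {d} (v : V d) → v ≢ 𝟘 → ∑[ s ] χ v s ≡ 0ℚ
∑-χ-≢𝟘 [] []≢[] = ⊥-elim ([]≢[] refl)
∑-χ-≢𝟘 (false ∷ v) v≢𝟘 =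
  cong₂ _+_ (∑-χ-≢𝟘 v (v≢𝟘 ∘ cong (false ∷_))) (∑-χ-≢𝟘 v (v≢𝟘 ∘ cong (false ∷_)))
∑-χ-≢𝟘 (true ∷ v) _ = begin
  ∑ (χ v) + (∑[ s ] sgn (1ℙ ℙ.+ ⟨ v , s ⟩))
    ≡⟨ cong (∑ (χ v) +_) (trans (∑-cong (λ s → sgn-homo-+ 1ℙ ⟨ v , s ⟩))
                                (sym (*-distribˡ-∑ (- 1ℚ) (χ v)))) ⟩
  ∑ (χ v) + - 1ℚ * ∑ (χ v)
    ≡⟨ x+-1*x≡0 (∑ (χ v)) ⟩
  0ℚ ∎
  where
  x+-1*x≡0 : ∀ x → x + - 1ℚ * x ≡ 0ℚ
  x+-1*x≡0 = solve-∀ ℚ-ring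

∑-χ-χ : ∀ {d} (u w : V d) → u ≢ w → ∑[ s ] χ s u * χ s w ≡ 0ℚ
∑-χ-χ u w u≢w =
  trans (∑-cong (λ s → trans (sym (χ-homoʳ s u w)) (cong sgn (⟨,⟩-comm s (u ⊕ w)))))
        (∑-χ-≢𝟘 (u ⊕ w) (u≢w ∘ ⊕≡𝟘⇒≡ u w))

∑-1 : ∀ d → ∑ {d} (λ _ → 1ℚ) ≡ ℕ→ℚ (2 ^ d)
∑-1 zero = refl
∑-1 (suc d) = begin
  ∑ {d} (λ _ → 1ℚ) + ∑ {d} (λ _ → 1ℚ)  ≡⟨ cong₂ _+_ (∑-1 d) (∑-1 d) ⟩
  ℕ→ℚ (2 ^ d) + ℕ→ℚ (2 ^ d)          ≡⟨ sym (ℕ→ℚ-homo-+ (2 ^ d) (2 ^ d)) ⟩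
  ℕ→ℚ (2 ^ d ℕ.+ 2 ^ d)              ≡⟨ cong (λ n → ℕ→ℚ (2 ^ d ℕ.+ n)) (sym (ℕ.+-identityʳ (2 ^ d))) ⟩
  ℕ→ℚ (2 ^ suc d)                    ∎

𝓕 : ∀ {d} → (V d → ℚ) → V d → ℚ
𝓕 f s = ∑[ u ] χ s u * f u

𝓕-inversion : ∀ {d} (f : V d → ℚ) u → ∑[ s ] χ s u * 𝓕 f s ≡ ℕ→ℚ (2 ^ d) * f u
𝓕-inversion {d} f u = begin
  ∑[ s ] χ s u * (∑[ w ] χ s w * f w)
    ≡⟨ ∑-cong (λ s → *-distribˡ-∑ (χ s u) (λ w → χ s w * f w)) ⟩
  ∑[ s ] ∑[ w ] χ s u * (χ s w * f w)
    ≡⟨ ∑-comm (λ s w → χ s u * (χ s w * f w)) ⟩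
  ∑[ w ] ∑[ s ] χ s u * (χ s w * f w)
    ≡⟨ ∑-cong (λ w → trans (∑-cong (λ s → sym (ℚ.*-assoc (χ s u) (χ s w) (f w))))
                            (sym (*-distribʳ-∑ (f w) (λ s → χ s u * χ s w)))) ⟩
  ∑[ w ] (∑[ s ] χ s u * χ s w) * f w
    ≡⟨ ∑-single u (λ w w≢u → trans (cong (_* f w) (∑-χ-χ u w (w≢u ∘ sym))) (ℚ.*-zeroˡ (f w))) ⟩
  (∑[ s ] χ s u * χ s u) * f u
    ≡⟨ cong (_* f u) (trans (∑-cong (λ s → sgn*sgn ⟨ s , u ⟩)) (∑-1 d)) ⟩
  ℕ→ℚ (2 ^ d) * f u ∎

𝓕-reflects-scaling : ∀ {d} μ (f g : V d → ℚ) → (∀ s → 𝓕 f s ≡ μ * 𝓕 g s) → ∀ u → f u ≡ μ * g u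
𝓕-reflects-scaling {d} μ f g 𝓕f≡μ𝓕g u = *-cancelˡ-≢0 (ℕ→ℚ (2 ^ d)) 2^d≢0 (begin
  ℕ→ℚ (2 ^ d) * f u                     ≡⟨ sym (𝓕-inversion f u) ⟩
  ∑[ s ] χ s u * 𝓕 f s                  ≡⟨ ∑-*-scale μ (λ s → χ s u) (𝓕 f) (𝓕 g) 𝓕f≡μ𝓕g ⟩
  μ * (∑[ s ] χ s u * 𝓕 g s)            ≡⟨ cong (μ *_) (𝓕-inversion g u) ⟩
  μ * (ℕ→ℚ (2 ^ d) * g u)               ≡⟨ *-left-comm μ (ℕ→ℚ (2 ^ d)) (g u) ⟩
  ℕ→ℚ (2 ^ d) * (μ * g u)               ∎)
  where
  2^d≢0 : ℕ→ℚ (2 ^ d) ≢ 0ℚ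
  2^d≢0 eq = ℕ.≢-nonZero⁻¹ (2 ^ d) {{ℕ.m^n≢0 2 d}} (ℕ→ℚ-injective eq)

-- The eigenvalues of H_m

eigenvalue : ∀ {d} → ℕ → V d → ℚ
eigenvalue m s = ∑[ z ] χ s z * weight m z

χ-eigenvector : ∀ {d} m (s : V d) → IsLeftEigenvector (H d m) (eigenvalue m s) (χ s)
χ-eigenvector m s w = begin
  ∑[ u ] χ s u * weight m (u ⊕ w)
    ≡⟨ sym (∑-translate w (λ u → χ s u * weight m (u ⊕ w))) ⟩
  ∑[ u ] χ s (u ⊕ w) * weight m ((u ⊕ w) ⊕ w)
    ≡⟨ ∑-cong (λ u → cong₂ _*_ (χ-homoʳ s u w) (cong (weight m) (⊕-cancelʳ u w))) ⟩
  ∑[ u ] χ s u * χ s w * weight m u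
    ≡⟨ ∑-cong (λ u → trans (cong (_* weight m u) (ℚ.*-comm (χ s u) (χ s w)))
                           (ℚ.*-assoc (χ s w) (χ s u) (weight m u))) ⟩
  ∑[ u ] χ s w * (χ s u * weight m u)
    ≡⟨ sym (*-distribˡ-∑ (χ s w) (λ u → χ s u * weight m u)) ⟩
  χ s w * eigenvalue m s
    ≡⟨ ℚ.*-comm (χ s w) (eigenvalue m s) ⟩
  eigenvalue m s * χ s w ∎

δ₀ δ₁ : ℕ → ℚ
δ₀ zero = 1ℚ
δ₀ (suc _) = 0ℚ
δ₁ zero = 0ℚ
δ₁ (suc k) = δ₀ k

weight-true : ∀ {n} m (z : V n) → weight m (true ∷ z) ≡ ℕ→ℚ m * δ₀ (numTrue z)
weight-true m z with numTrue z
... | zero = sym (ℚ.*-identityʳ (ℕ→ℚ m))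
... | suc _ = sym (ℚ.*-zeroʳ (ℕ→ℚ m))

weight-false : ∀ {n} m (z : V n) → weight m (false ∷ z) ≡ ℕ→ℚ 2 * δ₁ (numTrue z)
weight-false m z with numTrue z
... | zero = refl
... | suc zero = refl
... | suc (suc _) = refl

∑-χ-cons : ∀ {n} b (s : V n) (g : V (suc n) → ℚ) →
  ∑[ z ] χ (b ∷ s) z * g z ≡ (∑[ z ] χ s z * g (false ∷ z)) + sgn (bit b) * (∑[ z ] χ s z * g (true ∷ z))
∑-χ-cons b s g = cong₂ _+_
  (∑-cong (λ z → cong (λ x → sgn (bit x ℙ.+ ⟨ s , z ⟩) * g (false ∷ z)) (Bool.∧-zeroʳ b)))
  (trans (∑-cong (λ z → trans (cong (_* g (true ∷ z)) (χ-true z))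
                              (ℚ.*-assoc (sgn (bit b)) (χ s z) (g (true ∷ z)))))
         (sym (*-distribˡ-∑ (sgn (bit b)) (λ z → χ s z * g (true ∷ z)))))
  where
  χ-true : ∀ z → χ (b ∷ s) (true ∷ z) ≡ sgn (bit b) * χ s z
  χ-true z = trans (cong (λ x → sgn (bit x ℙ.+ ⟨ s , z ⟩)) (Bool.∧-identityʳ b))
                   (sgn-homo-+ (bit b) ⟨ s , z ⟩)

∑-χ-δ₀ : ∀ {n} (s : V n) → ∑[ z ] χ s z * δ₀ (numTrue z) ≡ 1ℚ
∑-χ-δ₀ [] = refl
∑-χ-δ₀ (b ∷ s) = begin
  ∑[ z ] χ (b ∷ s) z * δ₀ (numTrue z)
    ≡⟨ ∑-χ-cons b s (λ z → δ₀ (numTrue z)) ⟩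
  (∑[ z ] χ s z * δ₀ (numTrue z)) + sgn (bit b) * (∑[ z ] χ s z * 0ℚ)
    ≡⟨ cong₂ (λ x y → x + sgn (bit b) * y) (∑-χ-δ₀ s) (∑-zero (λ z → ℚ.*-zeroʳ (χ s z))) ⟩
  1ℚ + sgn (bit b) * 0ℚ
    ≡⟨ cong (1ℚ +_) (ℚ.*-zeroʳ (sgn (bit b))) ⟩
  1ℚ ∎

signSum : ∀ {n} → V n → ℚ
signSum [] = 0ℚ
signSum (b ∷ s) = sgn (bit b) + signSum s

∑-χ-δ₁ : ∀ {n} (s : V n) → ∑[ z ] χ s z * δ₁ (numTrue z) ≡ signSum s
∑-χ-δ₁ [] = refl
∑-χ-δ₁ (b ∷ s) = begin
  ∑[ z ] χ (b ∷ s) z * δ₁ (numTrue z)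
    ≡⟨ ∑-χ-cons b s (λ z → δ₁ (numTrue z)) ⟩
  (∑[ z ] χ s z * δ₁ (numTrue z)) + sgn (bit b) * (∑[ z ] χ s z * δ₀ (numTrue z))
    ≡⟨ cong₂ (λ x y → x + sgn (bit b) * y) (∑-χ-δ₁ s) (∑-χ-δ₀ s) ⟩
  signSum s + sgn (bit b) * 1ℚ
    ≡⟨ trans (cong (signSum s +_) (ℚ.*-identityʳ (sgn (bit b)))) (ℚ.+-comm (signSum s) (sgn (bit b))) ⟩
  signSum (b ∷ s) ∎

eigenvalue-cons : ∀ {n} m b (s : V n) →
  eigenvalue m (b ∷ s) ≡ ℕ→ℚ 2 * signSum s + sgn (bit b) * ℕ→ℚ m
eigenvalue-cons m b s = begin
  eigenvalue m (b ∷ s)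
    ≡⟨ ∑-χ-cons b s (weight m) ⟩
  (∑[ z ] χ s z * weight m (false ∷ z)) + sgn (bit b) * (∑[ z ] χ s z * weight m (true ∷ z))
    ≡⟨ cong₂ (λ x y → x + sgn (bit b) * y)
         (∑-*-scale (ℕ→ℚ 2) (χ s) (λ z → weight m (false ∷ z)) (λ z → δ₁ (numTrue z)) (weight-false m))
         (∑-*-scale (ℕ→ℚ m) (χ s) (λ z → weight m (true ∷ z)) (λ z → δ₀ (numTrue z)) (weight-true m)) ⟩
  ℕ→ℚ 2 * (∑[ z ] χ s z * δ₁ (numTrue z)) + sgn (bit b) * (ℕ→ℚ m * (∑[ z ] χ s z * δ₀ (numTrue z)))
    ≡⟨ cong₂ (λ x y → ℕ→ℚ 2 * x + sgn (bit b) * (ℕ→ℚ m * y)) (∑-χ-δ₁ s) (∑-χ-δ₀ s) ⟩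
  ℕ→ℚ 2 * signSum s + sgn (bit b) * (ℕ→ℚ m * 1ℚ)
    ≡⟨ cong (λ x → ℕ→ℚ 2 * signSum s + sgn (bit b) * x) (ℚ.*-identityʳ (ℕ→ℚ m)) ⟩
  ℕ→ℚ 2 * signSum s + sgn (bit b) * ℕ→ℚ m ∎

signSum-numTrue : ∀ {n} (s : V n) → signSum s + ℕ→ℚ 2 * ℕ→ℚ (numTrue s) ≡ ℕ→ℚ n
signSum-numTrue [] = refl
signSum-numTrue {suc n} (false ∷ s) = begin
  (1ℚ + signSum s) + ℕ→ℚ 2 * ℕ→ℚ (numTrue s)  ≡⟨ ℚ.+-assoc 1ℚ (signSum s) _ ⟩
  1ℚ + (signSum s + ℕ→ℚ 2 * ℕ→ℚ (numTrue s))  ≡⟨ cong (1ℚ +_) (signSum-numTrue s) ⟩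
  1ℚ + ℕ→ℚ n                                  ≡⟨ sym (ℕ→ℚ-homo-+ 1 n) ⟩
  ℕ→ℚ (suc n)                                 ∎
signSum-numTrue {suc n} (true ∷ s) = begin
  (- 1ℚ + signSum s) + ℕ→ℚ 2 * ℕ→ℚ (suc (numTrue s))
    ≡⟨ cong (λ x → (- 1ℚ + signSum s) + ℕ→ℚ 2 * x) (ℕ→ℚ-homo-+ 1 (numTrue s)) ⟩
  (- 1ℚ + signSum s) + ℕ→ℚ 2 * (1ℚ + ℕ→ℚ (numTrue s))
    ≡⟨ shuffle (signSum s) (ℕ→ℚ (numTrue s)) ⟩
  1ℚ + (signSum s + ℕ→ℚ 2 * ℕ→ℚ (numTrue s))
    ≡⟨ cong (1ℚ +_) (signSum-numTrue s) ⟩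
  1ℚ + ℕ→ℚ n
    ≡⟨ sym (ℕ→ℚ-homo-+ 1 n) ⟩
  ℕ→ℚ (suc n) ∎
  where
  shuffle : ∀ σ k → (- 1ℚ + σ) + (1ℚ + 1ℚ) * (1ℚ + k) ≡ 1ℚ + (σ + (1ℚ + 1ℚ) * k)
  shuffle = solve-∀ ℚ-ring

offset : ℕ → Bool → ℕ → ℕ
offset m false k = 2 ℕ.* k
offset m true  k = m ℕ.+ 2 ℕ.* k

eigenvalue-offset : ∀ {n} m b (s : V n) →
  eigenvalue m (b ∷ s) + ℕ→ℚ 2 * ℕ→ℚ (offset m b (numTrue s)) ≡ ℕ→ℚ m + ℕ→ℚ 2 * ℕ→ℚ n
eigenvalue-offset {n} m false s = begin
  eigenvalue m (false ∷ s) + ℕ→ℚ 2 * ℕ→ℚ (2 ℕ.* k)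
    ≡⟨ cong₂ (λ x y → x + ℕ→ℚ 2 * y) (eigenvalue-cons m false s) (ℕ→ℚ-homo-* 2 k) ⟩
  (ℕ→ℚ 2 * signSum s + 1ℚ * ℕ→ℚ m) + ℕ→ℚ 2 * (ℕ→ℚ 2 * ℕ→ℚ k)
    ≡⟨ shuffle (signSum s) (ℕ→ℚ m) (ℕ→ℚ k) ⟩
  ℕ→ℚ m + ℕ→ℚ 2 * (signSum s + ℕ→ℚ 2 * ℕ→ℚ k)
    ≡⟨ cong (λ x → ℕ→ℚ m + ℕ→ℚ 2 * x) (signSum-numTrue s) ⟩
  ℕ→ℚ m + ℕ→ℚ 2 * ℕ→ℚ n ∎
  where
  k : ℕ
  k = numTrue s
  shuffle : ∀ σ μ κ → ((1ℚ + 1ℚ) * σ + 1ℚ * μ) + (1ℚ + 1ℚ) * ((1ℚ + 1ℚ) * κ)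
                       ≡ μ + (1ℚ + 1ℚ) * (σ + (1ℚ + 1ℚ) * κ)
  shuffle = solve-∀ ℚ-ring
eigenvalue-offset {n} m true s = begin
  eigenvalue m (true ∷ s) + ℕ→ℚ 2 * ℕ→ℚ (m ℕ.+ 2 ℕ.* k)
    ≡⟨ cong₂ (λ x y → x + ℕ→ℚ 2 * y) (eigenvalue-cons m true s)
             (trans (ℕ→ℚ-homo-+ m (2 ℕ.* k)) (cong (ℕ→ℚ m +_) (ℕ→ℚ-homo-* 2 k))) ⟩
  (ℕ→ℚ 2 * signSum s + - 1ℚ * ℕ→ℚ m) + ℕ→ℚ 2 * (ℕ→ℚ m + ℕ→ℚ 2 * ℕ→ℚ k)
    ≡⟨ shuffle (signSum s) (ℕ→ℚ m) (ℕ→ℚ k) ⟩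
  ℕ→ℚ m + ℕ→ℚ 2 * (signSum s + ℕ→ℚ 2 * ℕ→ℚ k)
    ≡⟨ cong (λ x → ℕ→ℚ m + ℕ→ℚ 2 * x) (signSum-numTrue s) ⟩
  ℕ→ℚ m + ℕ→ℚ 2 * ℕ→ℚ n ∎
  where
  k : ℕ
  k = numTrue s
  shuffle : ∀ σ μ κ → ((1ℚ + 1ℚ) * σ + - 1ℚ * μ) + (1ℚ + 1ℚ) * (μ + (1ℚ + 1ℚ) * κ)
                       ≡ μ + (1ℚ + 1ℚ) * (σ + (1ℚ + 1ℚ) * κ)
  shuffle = solve-∀ ℚ-ring

≡eigenvalue⇒≡numTrue : ∀ {n} m → ¬ 2 ∣ m → (s t : V n) →
  eigenvalue m s ≡ eigenvalue m t → numTrue s ≡ numTrue t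
≡eigenvalue⇒≡numTrue m m-odd [] [] _ = refl
≡eigenvalue⇒≡numTrue m m-odd (b ∷ s) (c ∷ t) λs≡λt = offset-injective b c offset-eq
  where
  offset-eq : offset m b (numTrue s) ≡ offset m c (numTrue t)
  offset-eq = ℕ→ℚ-injective (*-cancelˡ-≢0 (ℕ→ℚ 2) (λ ())
    (+-cancelˡ (eigenvalue m (b ∷ s)) _ _
      (trans (eigenvalue-offset m b s)
             (sym (trans (cong (_+ _) λs≡λt) (eigenvalue-offset m c t))))))

  2∣m : ∀ {k k′} → m ℕ.+ 2 ℕ.* k ≡ 2 ℕ.* k′ → 2 ∣ m
  2∣m {k} {k′} eq =
    ∣m+n∣m⇒∣n (subst (2 ∣_) (trans (sym eq) (ℕ.+-comm m (2 ℕ.* k))) (m∣m*n k′)) (m∣m*n k)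

  offset-injective : ∀ b c → offset m b (numTrue s) ≡ offset m c (numTrue t) →
                     numTrue (b ∷ s) ≡ numTrue (c ∷ t)
  offset-injective false false eq = ℕ.*-cancelˡ-≡ _ _ 2 eq
  offset-injective true  true  eq = cong suc (ℕ.*-cancelˡ-≡ _ _ 2 (ℕ.+-cancelˡ-≡ m _ _ eq))
  offset-injective true  false eq = ⊥-elim (m-odd (2∣m {numTrue s} {numTrue t} eq))
  offset-injective false true  eq = ⊥-elim (m-odd (2∣m {numTrue t} {numTrue s} (sym eq)))

≡eigenvalue⇒≡⟨,𝟙⟩ : ∀ {n} m → ¬ 2 ∣ m → (s t : V n) →
  eigenvalue m s ≡ eigenvalue m t → ⟨ s , 𝟙 ⟩ ≡ ⟨ t , 𝟙 ⟩
≡eigenvalue⇒≡⟨,𝟙⟩ m m-odd s t λs≡λt = begin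
  ⟨ s , 𝟙 ⟩             ≡⟨ ⟨,𝟙⟩ s ⟩
  parity (numTrue s)    ≡⟨ cong parity (≡eigenvalue⇒≡numTrue m m-odd s t λs≡λt) ⟩
  parity (numTrue t)    ≡⟨ sym (⟨,𝟙⟩ t) ⟩
  ⟨ t , 𝟙 ⟩             ∎

signSum-⊕𝟙 : ∀ {n} (s : V n) → signSum (s ⊕ 𝟙) ≡ - signSum s
signSum-⊕𝟙 [] = refl
signSum-⊕𝟙 (false ∷ s) = trans (cong (- 1ℚ +_) (signSum-⊕𝟙 s)) (sym (ℚ.neg-distrib-+ 1ℚ (signSum s)))
signSum-⊕𝟙 (true ∷ s) = trans (cong (1ℚ +_) (signSum-⊕𝟙 s)) (flip (signSum s))
  where
  flip : ∀ σ → 1ℚ + - σ ≡ - (- 1ℚ + σ)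
  flip = solve-∀ ℚ-ring

eigenvalue-⊕𝟙 : ∀ {d} m (s : V d) → eigenvalue m (s ⊕ 𝟙) ≡ - eigenvalue m s
eigenvalue-⊕𝟙 m [] = refl
eigenvalue-⊕𝟙 m (b ∷ s) = begin
  eigenvalue m ((b xor true) ∷ (s ⊕ 𝟙))
    ≡⟨ eigenvalue-cons m (b xor true) (s ⊕ 𝟙) ⟩
  ℕ→ℚ 2 * signSum (s ⊕ 𝟙) + sgn (bit (b xor true)) * ℕ→ℚ m
    ≡⟨ cong₂ (λ x y → ℕ→ℚ 2 * x + y * ℕ→ℚ m) (signSum-⊕𝟙 s) (sgn-flip b) ⟩
  ℕ→ℚ 2 * - signSum s + - sgn (bit b) * ℕ→ℚ m
    ≡⟨ negate (ℕ→ℚ 2) (signSum s) (sgn (bit b)) (ℕ→ℚ m) ⟩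
  - (ℕ→ℚ 2 * signSum s + sgn (bit b) * ℕ→ℚ m)
    ≡⟨ cong -_ (sym (eigenvalue-cons m b s)) ⟩
  - eigenvalue m (b ∷ s) ∎
  where
  sgn-flip : ∀ b → sgn (bit (b xor true)) ≡ - sgn (bit b)
  sgn-flip false = refl
  sgn-flip true = refl
  negate : ∀ t σ ε μ → t * - σ + - ε * μ ≡ - (t * σ + ε * μ)
  negate = solve-∀ ℚ-ring

⟨⊕𝟙,𝟙⟩ : ∀ {d} (s : V d) → ⟨ s ⊕ 𝟙 , 𝟙 ⟩ ≡ ⟨ s , 𝟙 ⟩ ℙ.+ parity d
⟨⊕𝟙,𝟙⟩ {d} s =
  trans (⟨,⟩-homoˡ s 𝟙 𝟙) (cong (⟨ s , 𝟙 ⟩ ℙ.+_) (trans (⟨,𝟙⟩ (𝟙 {d})) (cong parity (numTrue-𝟙 d))))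

-- Λ, Λ[ 0ℙ ] and Λ[ 1ℙ ] are Λ_a, Λ⁺_ab and Λ⁻_ab seen through the characters.
Λ : ∀ d → ℕ → ℚ → Set
Λ d m λ' = Σ (V d) λ t → eigenvalue m t ≡ λ'

Λ[_] : Parity → ∀ d → ℕ → ℚ → Set
Λ[ p ] d m λ' = Σ (V d) λ t → eigenvalue m t ≡ λ' × ⟨ t , 𝟙 ⟩ ≡ p

Λ-neg : ∀ {d} m λ' → Λ d m λ' → Λ d m (- λ')
Λ-neg m λ' (t , λt≡λ) = t ⊕ 𝟙 , trans (eigenvalue-⊕𝟙 m t) (cong -_ λt≡λ)

Λ[]-neg : ∀ {d} m p λ' → Λ[ p ] d m λ' → Λ[ p ℙ.+ parity d ] d m (- λ')
Λ[]-neg m p λ' (t , λt≡λ , ⟨t,𝟙⟩≡p) =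
  t ⊕ 𝟙 , trans (eigenvalue-⊕𝟙 m t) (cong -_ λt≡λ) ,
  trans (⟨⊕𝟙,𝟙⟩ t) (cong (ℙ._+ _) ⟨t,𝟙⟩≡p)

Λ⇔Λ-neg : ∀ {d} m λ' → Λ d m λ' ⇔ Λ d m (- λ')
Λ⇔Λ-neg m λ' = mk⇔ (Λ-neg m λ') (subst (Λ _ m) (-‿involutive λ') ∘ Λ-neg m (- λ'))

Λ[]⇔Λ[]-neg : ∀ {d} m p λ' → Λ[ p ] d m λ' ⇔ Λ[ p ℙ.+ parity d ] d m (- λ')
Λ[]⇔Λ[]-neg {d} m p λ' = mk⇔ (Λ[]-neg m p λ')
  (subst₂ (λ q μ → Λ[ q ] d m μ) (cancel p) (-‿involutive λ') ∘ Λ[]-neg m _ (- λ'))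
  where
  cancel : ∀ p → p ℙ.+ parity d ℙ.+ parity d ≡ p
  cancel p = trans (ℙ.+-assoc p _ _) (trans (cong (p ℙ.+_) (ℙ.p+p≡0ℙ (parity d))) (ℙ.+-identityʳ p))

-- The eigenprojections of H_m

module _ {d m : ℕ} (m-odd : ¬ 2 ∣ m) (S : SpectralDecomp d (H d m)) where
  open SpectralDecomp S

  𝓕-column-≢ : ∀ i c t → eigenvalue m t ≢ ev i → 𝓕 (λ u → E i u c) t ≡ 0ℚ
  𝓕-column-≢ i c t = ⋆-eigen-≢ S {eigenvalue m t} {χ t} (χ-eigenvector m t) i c

  𝓕-column-≡ : ∀ i c t → eigenvalue m t ≡ ev i → 𝓕 (λ u → E i u c) t ≡ χ t c
  𝓕-column-≡ i c t = ⋆-eigen-≡ S {eigenvalue m t} {χ t} (χ-eigenvector m t) i c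

  columns-proportional : ∀ i c c′ μ → (∀ t → eigenvalue m t ≡ ev i → χ t c ≡ μ * χ t c′) →
                         ∀ u → E i u c ≡ μ * E i u c′
  columns-proportional i c c′ μ h = 𝓕-reflects-scaling μ (λ u → E i u c) (λ u → E i u c′) 𝓕-proportional
    where
    𝓕-proportional : ∀ t → 𝓕 (λ u → E i u c) t ≡ μ * 𝓕 (λ u → E i u c′) t
    𝓕-proportional t with eigenvalue m t ≟ ev i
    ... | yes λt≡ev = trans (𝓕-column-≡ i c t λt≡ev)
                      (trans (h t λt≡ev) (cong (μ *_) (sym (𝓕-column-≡ i c′ t λt≡ev))))
    ... | no λt≢ev = trans (𝓕-column-≢ i c t λt≢ev)
                     (trans (sym (ℚ.*-zeroʳ μ)) (cong (μ *_) (sym (𝓕-column-≢ i c′ t λt≢ev))))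

  χ-proportional : ∀ i c c′ μ → (∀ u → E i u c ≡ μ * E i u c′) →
                           ∀ t → eigenvalue m t ≡ ev i → χ t c ≡ μ * χ t c′
  χ-proportional i c c′ μ h t λt≡ev = begin
    χ t c                         ≡⟨ sym (𝓕-column-≡ i c t λt≡ev) ⟩
    𝓕 (λ u → E i u c) t           ≡⟨ ∑-*-scale μ (χ t) (λ u → E i u c) (λ u → E i u c′) h ⟩
    μ * 𝓕 (λ u → E i u c′) t      ≡⟨ cong (μ *_) (𝓕-column-≡ i c′ t λt≡ev) ⟩
    μ * χ t c′                    ∎

  ColNZ⇔Λ : ∀ i c → ColNZ S i c ⇔ Λ d m (ev i)
  ColNZ⇔Λ i c = mk⇔ to from
    where
    to : ColNZ S i c → Λ d m (ev i)
    to nz with any? (λ t → eigenvalue m t ≟ ev i)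
    ... | yes found = found
    ... | no none = ⊥-elim (nz (λ u → trans
            (columns-proportional i c c 0ℚ (λ t λt≡ev → ⊥-elim (none (t , λt≡ev))) u)
            (ℚ.*-zeroˡ (E i u c))))
    from : Λ d m (ev i) → ColNZ S i c
    from (t , λt≡ev) column≡0 = sgn≢0 ⟨ t , c ⟩ (trans (sym (𝓕-column-≡ i c t λt≡ev))
      (∑-zero (λ u → trans (cong (χ t u *_) (column≡0 u)) (ℚ.*-zeroʳ (χ t u)))))

  eigenvalue∈ev : ∀ t → ∃ λ i → ev i ≡ eigenvalue m t
  eigenvalue∈ev t = left-eigenvalue∈ev S {eigenvalue m t} {χ t} (χ-eigenvector m t) 𝟘 (sgn≢0 ⟨ t , 𝟘 ⟩)

  InSupp⇔Λ : ∀ λ' → InSupp S 𝟘 λ' ⇔ Λ d m λ'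
  InSupp⇔Λ λ' = mk⇔ to from
    where
    to : InSupp S 𝟘 λ' → Λ d m λ'
    to (i , ev≡λ , nz) = let (t , λt≡ev) = Equivalence.to (ColNZ⇔Λ i 𝟘) nz in t , trans λt≡ev ev≡λ
    from : Λ d m λ' → InSupp S 𝟘 λ'
    from (t , λt≡λ) = let (i , ev≡λt) = eigenvalue∈ev t in
      i , trans ev≡λt λt≡λ , Equivalence.from (ColNZ⇔Λ i 𝟘) (t , sym ev≡λt)

  χ𝟘≡sgn*χ𝟙 : ∀ (t : V d) p → ⟨ t , 𝟙 ⟩ ≡ p → χ t 𝟘 ≡ sgn p * χ t 𝟙
  χ𝟘≡sgn*χ𝟙 t p ⟨t,𝟙⟩≡p =
    trans (χ-𝟘 t) (trans (sym (sgn*sgn ⟨ t , 𝟙 ⟩)) (cong (λ q → sgn q * χ t 𝟙) ⟨t,𝟙⟩≡p))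

  strongly-cospectral : StronglyCospectral S 𝟘 𝟙
  strongly-cospectral i with any? (λ t → eigenvalue m t ≟ ev i)
  ... | yes (t , λt≡ev) = sgn ⟨ t , 𝟙 ⟩ , sgn≡±1 ⟨ t , 𝟙 ⟩ ,
          columns-proportional i 𝟘 𝟙 (sgn ⟨ t , 𝟙 ⟩) (λ t′ λt′≡ev → χ𝟘≡sgn*χ𝟙 t′ ⟨ t , 𝟙 ⟩
            (≡eigenvalue⇒≡⟨,𝟙⟩ m m-odd t′ t (trans λt′≡ev (sym λt≡ev))))
  ... | no none = 1ℚ , inj₁ refl ,
          columns-proportional i 𝟘 𝟙 1ℚ (λ t λt≡ev → ⊥-elim (none (t , λt≡ev)))

  proportional⇒Λ[] : ∀ p i → (∀ u → E i u 𝟘 ≡ sgn p * E i u 𝟙) → ColNZ S i 𝟘 → Λ[ p ] d m (ev i)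
  proportional⇒Λ[] p i 𝟘∝𝟙 nz = t , λt≡ev ,
      sym (1≡sgn*sgn⇒≡ p ⟨ t , 𝟙 ⟩
             (trans (sym (χ-𝟘 t)) (χ-proportional i 𝟘 𝟙 (sgn p) 𝟘∝𝟙 t λt≡ev)))
    where
    t : V d
    t = proj₁ (Equivalence.to (ColNZ⇔Λ i 𝟘) nz)
    λt≡ev : eigenvalue m t ≡ ev i
    λt≡ev = proj₂ (Equivalence.to (ColNZ⇔Λ i 𝟘) nz)

  Λ[]⇒proportional : ∀ p λ' → Λ[ p ] d m λ' →
    Σ (Fin r) λ i → ev i ≡ λ' × (∀ u → E i u 𝟘 ≡ sgn p * E i u 𝟙) × ColNZ S i 𝟘
  Λ[]⇒proportional p λ' (t , λt≡λ , ⟨t,𝟙⟩≡p) = i , trans ev≡λt λt≡λ ,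
      columns-proportional i 𝟘 𝟙 (sgn p) (λ t′ λt′≡ev → χ𝟘≡sgn*χ𝟙 t′ p
        (trans (≡eigenvalue⇒≡⟨,𝟙⟩ m m-odd t′ t (trans λt′≡ev ev≡λt)) ⟨t,𝟙⟩≡p)) ,
      Equivalence.from (ColNZ⇔Λ i 𝟘) (t , sym ev≡λt)
    where
    i : Fin r
    i = proj₁ (eigenvalue∈ev t)
    ev≡λt : ev i ≡ eigenvalue m t
    ev≡λt = proj₂ (eigenvalue∈ev t)

  InSign : Parity → ℚ → Set
  InSign 0ℙ = InPlus S 𝟘 𝟙
  InSign 1ℙ = InMinus S 𝟘 𝟙

  InSign⇔Λ[] : ∀ p λ' → InSign p λ' ⇔ Λ[ p ] d m λ'
  InSign⇔Λ[] 0ℙ λ' = mk⇔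
    (λ (i , ev≡λ , 𝟘≡𝟙 , nz) → subst (Λ[ 0ℙ ] d m) ev≡λ
       (proportional⇒Λ[] 0ℙ i (λ u → trans (𝟘≡𝟙 u) (sym (ℚ.*-identityˡ (E i u 𝟙)))) nz))
    (λ x → let (i , ev≡λ , 𝟘≡𝟙 , nz) = Λ[]⇒proportional 0ℙ λ' x in
       i , ev≡λ , (λ u → trans (𝟘≡𝟙 u) (ℚ.*-identityˡ (E i u 𝟙))) , nz)
  InSign⇔Λ[] 1ℙ λ' = mk⇔
    (λ (i , ev≡λ , 𝟘≡-𝟙 , nz) → subst (Λ[ 1ℙ ] d m) ev≡λ
       (proportional⇒Λ[] 1ℙ i (λ u → trans (𝟘≡-𝟙 u) (sym (-1*x≈-x (E i u 𝟙)))) nz))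
    (λ x → let (i , ev≡λ , 𝟘≡-𝟙 , nz) = Λ[]⇒proportional 1ℙ λ' x in
       i , ev≡λ , (λ u → trans (𝟘≡-𝟙 u) (-1*x≈-x (E i u 𝟙))) , nz)

  InSign-neg : ∀ {q} → parity d ≡ q → ∀ p λ' → InSign p λ' ⇔ InSign (p ℙ.+ q) (- λ')
  InSign-neg refl p λ' = ⇔-sym (InSign⇔Λ[] _ (- λ')) ⇔-∘ (Λ[]⇔Λ[]-neg m p λ' ⇔-∘ InSign⇔Λ[] p λ')

  InSupp-neg : ∀ λ' → InSupp S 𝟘 λ' ⇔ InSupp S 𝟘 (- λ')
  InSupp-neg λ' = ⇔-sym (InSupp⇔Λ (- λ')) ⇔-∘ (Λ⇔Λ-neg m λ' ⇔-∘ InSupp⇔Λ λ')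

lemma4p4 : (d m : ℕ) → 1 ≤ d → 0 < m → ¬ (2 ∣ m) →
    (S : SpectralDecomp d (H d m)) →
    StronglyCospectral S (replicate d false) (replicate d true)
    × (∀ λ' → InSupp S (replicate d false) λ' ⇔ InSupp S (replicate d false) (- λ'))
    × (2 ∣ d → ∀ λ' →
        (InPlus S (replicate d false) (replicate d true) λ' ⇔ InPlus S (replicate d false) (replicate d true) (- λ'))
        × (InMinus S (replicate d false) (replicate d true) λ' ⇔ InMinus S (replicate d false) (replicate d true) (- λ')))
    × (¬ (2 ∣ d) → ∀ λ' →
        (InPlus S (replicate d false) (replicate d true) λ' ⇔ InMinus S (replicate d false) (replicate d true) (- λ'))
        × (InMinus S (replicate d false) (replicate d true) λ' ⇔ InPlus S (replicate d false) (replicate d true) (- λ')))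
lemma4p4 d m _ _ m-odd S =
    strongly-cospectral m-odd S
  , InSupp-neg m-odd S
  , (λ 2∣d λ' → InSign-neg m-odd S (2∣⇒parity≡0ℙ 2∣d) 0ℙ λ'
               , InSign-neg m-odd S (2∣⇒parity≡0ℙ 2∣d) 1ℙ λ')
  , (λ ¬2∣d λ' → InSign-neg m-odd S (¬2∣⇒parity≡1ℙ ¬2∣d) 0ℙ λ'
                , InSign-neg m-odd S (¬2∣⇒parity≡1ℙ ¬2∣d) 1ℙ λ')
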